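{- Let $S=\{m\}$ be admissible (i.e. $1\le m\le n-1$). Then \[\#\widehat{P}(S,n)=\sum_{i=1}^{m}2^{n-i}\binom{n}{i-1}(-1)^{m-i}-(m\bmod 2).\]
   Context: $S_n$ is the set of permutations $\pi=\pi_1\cdots\pi_n$ of $\{1,\dots,n\}$. Set $\pi_0=0$. An index $i\in\{1,\dots,n-1\}$ is a peak of $\pi$ if $\pi_{i-1}<\pi_i>\pi_{i+1}$. $\widehat{P}(S,n)$ is the set of $\pi\in S_n$ whose peak set (in this sense) equals $S$. $m\bmod 2\in\{0,1\}$ is the remainder of $m$ modulo $2$. -}

module Defs where

open import Data.Nat using (ℕ; zero; suc; _+_; _*_; _∸_; _^_; _≤_; _<_; _<?_; _≤?_)
open import Data.Nat.Properties using (≤-refl)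
open import Data.Nat.Combinatorics using (_C_)
open import Data.Fin using (Fin; toℕ; fromℕ<)
import Data.Fin.Properties as FinP
open import Data.Vec using (Vec; []; _∷_; lookup; toList)
open import Data.List using (List; []; _∷_; map; concatMap; filter; length; upTo; allFin; foldr)
import Data.List.Properties as ListP
import Data.List.Relation.Unary.Unique.DecPropositional as UDP
open import Data.Product using (_×_)
open import Relation.Nullary.Decidable using (Dec; yes; no; _×-dec_)
open import Relation.Binary.PropositionalEquality using (_≡_)
open import Data.Integer as ℤ using (ℤ; +_; -1ℤ)

allVecs : (n k : ℕ) → List (Vec (Fin n) k)
allVecs n zero    = [] ∷ []
allVecs n (suc k) = concatMap (λ x → map (x ∷_) (allVecs n k)) (allFin n)

-- S_n: words of length n over {1..n} (stored 0-based as Fin n) with distinct letters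
IsPerm : {n : ℕ} → Vec (Fin n) n → Set
IsPerm {n} v = UDP.Unique (FinP._≟_ {n}) (toList v)

isPerm? : {n : ℕ} (v : Vec (Fin n) n) → Dec (IsPerm v)
isPerm? {n} v = UDP.unique? (FinP._≟_ {n}) (toList v)

-- the value π_i ∈ {1..n} for 1 ≤ i ≤ n, with the convention π_0 = 0
-- (indices beyond n are given the dummy value 0; they are never peaks)
val : {n : ℕ} → Vec (Fin n) n → ℕ → ℕ
val {n} v zero = 0
val {n} v (suc j) with j <? n
... | yes p = suc (toℕ (lookup v (fromℕ< p)))
... | no _  = 0

IsPeak : {n : ℕ} → Vec (Fin n) n → ℕ → Set
IsPeak {n} v i = (1 ≤ i) × (i ≤ n ∸ 1) × (val v (i ∸ 1) < val v i) × (val v (suc i) < val v i)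

isPeak? : {n : ℕ} (v : Vec (Fin n) n) (i : ℕ) → Dec (IsPeak v i)
isPeak? {n} v i = (1 ≤? i) ×-dec ((i ≤? n ∸ 1) ×-dec ((val v (i ∸ 1) <? val v i) ×-dec (val v (suc i) <? val v i)))

peakSet : {n : ℕ} → Vec (Fin n) n → List ℕ
peakSet {n} v = filter (isPeak? v) (upTo n)

InPhat1 : (m n : ℕ) → Vec (Fin n) n → Set
InPhat1 m n v = IsPerm v × (peakSet v ≡ m ∷ [])

inPhat1? : (m n : ℕ) (v : Vec (Fin n) n) → Dec (InPhat1 m n v)
inPhat1? m n v = isPerm? v ×-dec ListP.≡-dec Data.Nat._≟_ (peakSet v) (m ∷ [])
  where import Data.Nat

countPhat1 : (m n : ℕ) → ℕ
countPhat1 m n = length (filter (inPhat1? m n) (allVecs n n))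

sumℤ : List ℤ → ℤ
sumℤ = foldr ℤ._+_ (+ 0)

formula : (m n : ℕ) → ℤ
formula m n =
  sumℤ (map (λ j → let i = suc j in (+ (2 ^ (n ∸ i) * (n C (i ∸ 1)))) ℤ.* (-1ℤ ℤ.^ (m ∸ i))) (upTo m))
  ℤ.- (+ (m Data.Nat.% 2))
  where import Data.Nat

module Submission where

-- Everything is counted by removing the
-- maximum letter: a permutation of length n+1 is ins p n z for a unique position p ≤ n and a
-- permutation z of length n (permCount-suc).  Inserting a new maximum at the end of a word keeps
-- its peaks, in front shifts them, and strictly inside creates exactly one new peak there
-- (peaks-max-end / -front / -inside).  For peakCount m N (peak set {m}) and splitCount k N
-- (increasing up to position k, peak-free afterwards) this yields
--   peakCount (m+1) (n+1) = splitCount m n + peakCount (m+1) n,      peakCount m m = 0,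
--   splitCount k n = 2^(n-k-1) C(n, k)
-- (choose the prefix; every later letter except the minimum lies left or right of the minimum).
-- The paper's alternating sum satisfies the same recursion in n (Pascal's rule and a sign flip),
-- hence equals peakCount.

open import Defs
open import Relation.Binary.PropositionalEquality hiding ([_])
open import Data.Nat using (ℕ; zero; suc; _+_; _*_; _∸_; _^_; _%_; _≤_; _<_; _≤′_; ≤′-refl; ≤′-step; z≤n; s≤s; _≟_; _<?_; _≤?_)
open import Data.Nat.Properties
open import Data.Nat.Combinatorics using (_C_; nCn≡1; nC1≡n; nCk≡nC[n∸k]; nCk+nC[k+1]≡[n+1]C[k+1])
import Data.Nat.Tactic.RingSolver as ℕ-Solver
open import Data.Fin using (Fin; toℕ; fromℕ<)
import Data.Fin.Properties as Fin
open import Data.Vec using (Vec; []; _∷_; lookup; toList)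
open import Data.Vec.Properties using (length-toList)
open import Data.List using (List; []; _∷_; _++_; [_]; length; map; filter; take; drop; upTo; applyUpTo; tabulate; allFin; concatMap; cartesianProductWith)
open import Data.List.Properties using (map-∘; map-++; map-id-local; map-upTo; map-tabulate; ++-assoc; take++drop≡id; length-upTo; length-map; length-take; length-drop; length-++-sucʳ; upTo-∷ʳ; filter-accept; filter-reject)
import Data.List.Properties as List
open import Data.List.Membership.Propositional using (_∈_; _∉_)
open import Data.List.Membership.Propositional.Properties using (∈-filter⁻; ∈-filter⁺; ∈-map⁻; ∈-map⁺; ∈-upTo⁺; ∈-upTo⁻; ∈-∃++; ∈-++⁻; ∈-++⁺ˡ; ∈-++⁺ʳ; ∈-cartesianProductWith⁺; ∈-cartesianProductWith⁻)
open import Data.List.Membership.Propositional.Properties.WithK using (unique∧set⇒bag)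
open import Data.List.Membership.DecPropositional _≟_ using (_∈?_)
open import Data.List.Relation.Binary.BagAndSetEquality using (∼bag⇒↭)
open import Data.List.Relation.Binary.Permutation.Propositional using (_↭_; ↭-sym; ↭⇒↭ₛ)
open import Data.List.Relation.Binary.Permutation.Propositional.Properties using (↭-length; shift; All-resp-↭)
open import Data.List.Relation.Binary.Permutation.Setoid.Properties (setoid ℕ) using (Unique-resp-↭)
open import Data.List.Relation.Unary.Any using (here; there)
open import Data.List.Relation.Unary.All as All using (All; []; _∷_)
import Data.List.Relation.Unary.All.Properties as All
open import Data.List.Relation.Unary.AllPairs using ([]; _∷_)
open import Data.List.Relation.Unary.Unique.Propositional using (Unique)
import Data.List.Relation.Unary.Unique.Propositional.Properties as Unique
import Data.List.Relation.Unary.Unique.DecPropositional as UniqueDec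
open import Data.Maybe using (Maybe; just; nothing)
import Data.Maybe.Properties as Maybe
open import Data.Product using (∃-syntax; _×_; _,_; proj₁; proj₂)
open import Data.Sum using (inj₁; inj₂)
open import Data.Empty using (⊥-elim)
open import Function using (_⇔_; mk⇔; Equivalence; case_of_)
open import Relation.Nullary using (¬_; Dec; yes; no; ¬?)
open import Relation.Nullary.Decidable using (_×-dec_)
open import Relation.Unary using (Decidable)

module ⇔ = Equivalence

count : {A : Set} {P : A → Set} → Decidable P → List A → ℕ
count P? xs = length (filter P? xs)

count-none : {A : Set} {P : A → Set} (P? : Decidable P) →
  ∀ xs → (∀ {x} → x ∈ xs → ¬ P x) → count P? xs ≡ 0
count-none P? [] _ = refl
count-none P? (x ∷ xs) ¬P with P? x
... | yes px = ⊥-elim (¬P (here refl) px)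
... | no _   = count-none P? xs (λ m → ¬P (there m))

module _ {A : Set} {P Q : A → Set} (P? : Decidable P) (Q? : Decidable Q) where

  filter-cong : ∀ xs → (∀ {x} → x ∈ xs → P x ⇔ Q x) → filter P? xs ≡ filter Q? xs
  filter-cong [] _ = refl
  filter-cong (x ∷ xs) P⇔Q with P? x | Q? x
  ... | yes _  | yes _  = cong (x ∷_) (filter-cong xs (λ m → P⇔Q (there m)))
  ... | no _   | no _   = filter-cong xs (λ m → P⇔Q (there m))
  ... | yes px | no ¬qx = ⊥-elim (¬qx (⇔.to (P⇔Q (here refl)) px))
  ... | no ¬px | yes qx = ⊥-elim (¬px (⇔.from (P⇔Q (here refl)) qx))

  count-cong : ∀ xs → (∀ {x} → x ∈ xs → P x ⇔ Q x) → count P? xs ≡ count Q? xs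
  count-cong xs P⇔Q = cong length (filter-cong xs P⇔Q)

  count-partition : ∀ xs →
    count P? xs ≡ count (λ x → P? x ×-dec Q? x) xs + count (λ x → P? x ×-dec ¬? (Q? x)) xs
  count-partition [] = refl
  count-partition (x ∷ xs) with P? x | Q? x
  ... | no _  | _     = count-partition xs
  ... | yes _ | yes _ = cong suc (count-partition xs)
  ... | yes _ | no _  = trans (cong suc (count-partition xs)) (sym (+-suc _ _))

filter-map : {A B : Set} {Q : B → Set} (Q? : Decidable Q) (f : A → B) →
  ∀ xs → filter Q? (map f xs) ≡ map f (filter (λ x → Q? (f x)) xs)
filter-map Q? f [] = refl
filter-map Q? f (x ∷ xs) with Q? (f x)
... | yes _ = cong (f x ∷_) (filter-map Q? f xs)
... | no _  = filter-map Q? f xs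

module _ {A B : Set} {P : A → Set} {Q : B → Set} (P? : Decidable P) (Q? : Decidable Q) where

  count-map : (f : A → B) → (∀ x → P x ⇔ Q (f x)) → ∀ xs → count P? xs ≡ count Q? (map f xs)
  count-map f P⇔Qf xs = begin
      count P? xs
    ≡⟨ count-cong P? (λ x → Q? (f x)) xs (λ {x} _ → P⇔Qf x) ⟩
      length (filter (λ x → Q? (f x)) xs)
    ≡⟨ sym (length-map f (filter (λ x → Q? (f x)) xs)) ⟩
      length (map f (filter (λ x → Q? (f x)) xs))
    ≡⟨ cong length (sym (filter-map Q? f xs)) ⟩
      count Q? (map f xs)
    ∎
    where open ≡-Reasoning

  count-bijection : ∀ xs ys → Unique xs → Unique ys → (f : A → B) (g : B → A) →
    (∀ {x} → x ∈ xs → P x → f x ∈ ys × Q (f x) × g (f x) ≡ x) →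
    (∀ {y} → y ∈ ys → Q y → g y ∈ xs × P (g y) × f (g y) ≡ y) →
    count P? xs ≡ count Q? ys
  count-bijection xs ys xs! ys! f g forth back =
    trans (sym (length-map f Ps)) (↭-length (∼bag⇒↭ (unique∧set⇒bag fPs! (Unique.filter⁺ Q? ys!) (mk⇔ to from))))
    where
    Ps = filter P? xs
    g∘f≡id : map g (map f Ps) ≡ Ps
    g∘f≡id = trans (sym (map-∘ Ps)) (map-id-local (All.tabulate λ m →
      let (m' , px) = ∈-filter⁻ P? m in proj₂ (proj₂ (forth m' px))))
    fPs! : Unique (map f Ps)
    fPs! = Unique.map⁻ (subst Unique (sym g∘f≡id) (Unique.filter⁺ P? xs!))
    to : ∀ {y} → y ∈ map f Ps → y ∈ filter Q? ys
    to m with ∈-map⁻ f m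
    ... | x , mx , refl = let (mx' , px) = ∈-filter⁻ P? mx; (fx∈ , qfx , _) = forth mx' px in ∈-filter⁺ Q? fx∈ qfx
    from : ∀ {y} → y ∈ filter Q? ys → y ∈ map f Ps
    from m with ∈-filter⁻ Q? m
    ... | my , qy with back my qy
    ... | gy∈ , pgy , fgy≡y = subst (_∈ map f Ps) fgy≡y (∈-map⁺ f (∈-filter⁺ P? gy∈ pgy))

sumTo : ℕ → (ℕ → ℕ) → ℕ
sumTo zero    f = 0
sumTo (suc N) f = sumTo N f + f N

sumTo-cong : ∀ N {f g : ℕ → ℕ} → (∀ k → k < N → f k ≡ g k) → sumTo N f ≡ sumTo N g
sumTo-cong zero    f≡g = refl
sumTo-cong (suc N) f≡g = cong₂ _+_ (sumTo-cong N (λ k k<N → f≡g k (m<n⇒m<1+n k<N))) (f≡g N ≤-refl)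

sumTo-zero : ∀ N {f : ℕ → ℕ} → (∀ k → k < N → f k ≡ 0) → sumTo N f ≡ 0
sumTo-zero N f≡0 = trans (sumTo-cong N f≡0) (zeros N)
  where
  zeros : ∀ N → sumTo N (λ _ → 0) ≡ 0
  zeros zero    = refl
  zeros (suc N) = cong (_+ 0) (zeros N)

sumTo-upto : ∀ {j} N {f : ℕ → ℕ} → j ≤ N → (∀ k → j ≤ k → k < N → f k ≡ 0) → sumTo N f ≡ sumTo j f
sumTo-upto N j≤N f≡0 with m≤n⇒m<n∨m≡n j≤N
... | inj₂ refl = refl
sumTo-upto (suc N) _ f≡0 | inj₁ j<1+N = trans
  (cong₂ _+_ (sumTo-upto N (≤-pred j<1+N) (λ k j≤k k<N → f≡0 k j≤k (m<n⇒m<1+n k<N))) (f≡0 N (≤-pred j<1+N) ≤-refl))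
  (+-identityʳ _)

module _ {A : Set} {M : ℕ → A → Set} (M? : ∀ k → Decidable (M k)) where

  InUniqueClass : ℕ → A → Set
  InUniqueClass N x = ∃[ k ] (k < N × M k x × (∀ j → M j x → j ≡ k))

  count-classes : ∀ {P : A → Set} (P? : Decidable P) N xs → (∀ {x} → x ∈ xs → P x → InUniqueClass N x) →
    count P? xs ≡ sumTo N (λ k → count (λ x → P? x ×-dec M? k x) xs)
  count-classes P? zero xs class = count-none P? xs (λ m px → let (_ , k<0 , _) = class m px in n≮0 k<0)
  count-classes {P} P? (suc N) xs class = begin
      count P? xs
    ≡⟨ count-partition P? (M? N) xs ⟩
      inN + count P∖N? xs
    ≡⟨ +-comm inN (count P∖N? xs) ⟩
      count P∖N? xs + inN
    ≡⟨ cong (_+ inN) (count-classes P∖N? N xs classBelowN) ⟩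
      sumTo N (λ k → count (λ x → P∖N? x ×-dec M? k x) xs) + inN
    ≡⟨ cong (_+ inN) (sumTo-cong N (λ k k<N → count-cong _ _ xs (λ m → notInN k<N m))) ⟩
      sumTo N (λ k → count (λ x → P? x ×-dec M? k x) xs) + inN
    ∎
    where
    open ≡-Reasoning
    P∖N? = λ x → P? x ×-dec ¬? (M? N x)
    inN = count (λ x → P? x ×-dec M? N x) xs
    classBelowN : ∀ {x} → x ∈ xs → P x × ¬ M N x → InUniqueClass N x
    classBelowN m (px , ¬mN) with class m px
    ... | k , k<1+N , mk , only-k = k , ≤∧≢⇒< (≤-pred k<1+N) (λ { refl → ¬mN mk }) , mk , only-k
    notInN : ∀ {k x} → k < N → x ∈ xs → ((P x × ¬ M N x) × M k x) ⇔ (P x × M k x)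
    notInN {k} k<N m = mk⇔ (λ ((px , _) , mk) → px , mk) (λ (px , mk) → (px , λ mN →
      let (_ , _ , _ , only) = class m px in <-irrefl (trans (only k mk) (sym (only N mN))) k<N) , mk)

ins : ℕ → ℕ → List ℕ → List ℕ
ins p M z = take p z ++ M ∷ drop p z

del : ℕ → List ℕ → List ℕ
del _       []      = []
del zero    (a ∷ x) = x
del (suc p) (a ∷ x) = a ∷ del p x

at : List ℕ → ℕ → Maybe ℕ
at []      _       = nothing
at (a ∷ x) zero    = just a
at (a ∷ x) (suc p) = at x p

ins-↭ : ∀ p M z → ins p M z ↭ M ∷ z
ins-↭ p M z = subst (λ t → ins p M z ↭ M ∷ t) (take++drop≡id p z) (shift M (take p z) (drop p z))

length-ins : ∀ p M z → length (ins p M z) ≡ suc (length z)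
length-ins p M z = ↭-length (ins-↭ p M z)

unique-ins : ∀ p M z → Unique (ins p M z) ⇔ (M ∉ z × Unique z)
unique-ins p M z = mk⇔
  (λ u → case Unique-resp-↭ (↭⇒↭ₛ (ins-↭ p M z)) u of λ { (M∉ ∷ z!) → All.All¬⇒¬Any M∉ , z! })
  (λ (M∉z , z!) → Unique-resp-↭ (↭⇒↭ₛ (↭-sym (ins-↭ p M z))) (All.¬Any⇒All¬ z M∉z ∷ z!))

all-ins : ∀ {P : ℕ → Set} p M z → P M → All P z → All P (ins p M z)
all-ins p M z pM all = All-resp-↭ (↭-sym (ins-↭ p M z)) (pM ∷ all)

all-ins⁻ : ∀ {P : ℕ → Set} p M z → All P (ins p M z) → All P z
all-ins⁻ p M z all with All-resp-↭ (ins-↭ p M z) all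
... | _ ∷ allz = allz

ins-del : ∀ x p {M} → at x p ≡ just M → ins p M (del p x) ≡ x
ins-del (a ∷ x) zero    refl = refl
ins-del (a ∷ x) (suc p) e    = cong (a ∷_) (ins-del x p e)

del-ins : ∀ z p {M} → p ≤ length z → del p (ins p M z) ≡ z
del-ins z       zero    _         = refl
del-ins (a ∷ z) (suc p) (s≤s p≤) = cong (a ∷_) (del-ins z p p≤)

at-ins : ∀ z p {M} → p ≤ length z → at (ins p M z) p ≡ just M
at-ins z       zero    _         = refl
at-ins (a ∷ z) (suc p) (s≤s p≤) = at-ins z p p≤

at-∈ : ∀ x p {M} → at x p ≡ just M → M ∈ x
at-∈ (a ∷ x) zero    refl = here refl
at-∈ (a ∷ x) (suc p) e    = there (at-∈ x p e)

∈-at : ∀ x {M} → M ∈ x → ∃[ p ] (p < length x × at x p ≡ just M)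
∈-at (a ∷ x) (here refl) = 0 , s≤s z≤n , refl
∈-at (a ∷ x) (there m) = let (p , p< , e) = ∈-at x m in suc p , s≤s p< , e

at-unique : ∀ x p q {M} → Unique x → at x p ≡ just M → at x q ≡ just M → p ≡ q
at-unique (a ∷ x) zero    zero    _         _  _  = refl
at-unique (a ∷ x) zero    (suc q) (a∉ ∷ _)  refl e = ⊥-elim (All.lookup a∉ (at-∈ x q e) refl)
at-unique (a ∷ x) (suc p) zero    (a∉ ∷ _)  e refl = ⊥-elim (All.lookup a∉ (at-∈ x p e) refl)
at-unique (a ∷ x) (suc p) (suc q) (_ ∷ x!)  e  e' = cong suc (at-unique x p q x! e e')

take-ins-before : ∀ q k L M → q ≤ k → take (suc k) (ins q M L) ≡ ins q M (take k L)
take-ins-before zero    k       L       M _         = refl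
take-ins-before (suc q) (suc k) []      M _         = refl
take-ins-before (suc q) (suc k) (a ∷ L) M (s≤s q≤k) = cong (a ∷_) (take-ins-before q k L M q≤k)

drop-ins-before : ∀ q k L M → q ≤ k → drop (suc k) (ins q M L) ≡ drop k L
drop-ins-before zero    k       L       M _         = refl
drop-ins-before (suc q) (suc k) []      M _         = refl
drop-ins-before (suc q) (suc k) (a ∷ L) M (s≤s q≤k) = drop-ins-before q k L M q≤k

take-ins-after : ∀ j q L M → j ≤ q → q ≤ length L → take j (ins q M L) ≡ take j L
take-ins-after zero    q       L       M _         _         = refl
take-ins-after (suc j) (suc q) (a ∷ L) M (s≤s j≤q) (s≤s q≤L) = cong (a ∷_) (take-ins-after j q L M j≤q q≤L)

drop-ins-after : ∀ j q L M → j ≤ q → q ≤ length L → drop j (ins q M L) ≡ ins (q ∸ j) M (drop j L)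
drop-ins-after zero    q       L       M _         _         = refl
drop-ins-after (suc j) (suc q) (a ∷ L) M (s≤s j≤q) (s≤s q≤L) = drop-ins-after j q L M j≤q q≤L

++-∷-≢-[] : ∀ (A : List ℕ) {b B} → A ++ b ∷ B ≢ []
++-∷-≢-[] []      ()
++-∷-≢-[] (_ ∷ _) ()

++-∷-singleton : ∀ (A : List ℕ) {b B m} → A ++ b ∷ B ≡ [ m ] → A ≡ [] × b ≡ m × B ≡ []
++-∷-singleton []          refl = refl , refl , refl
++-∷-singleton (_ ∷ [])    ()
++-∷-singleton (_ ∷ _ ∷ _) ()

map-≡-[] : ∀ {f : ℕ → ℕ} (l : List ℕ) → map f l ≡ [] → l ≡ []
map-≡-[] [] _ = refl

unique-length : ∀ (xs ys : List ℕ) → Unique xs → (∀ {y} → y ∈ xs → y ∈ ys) → length xs ≤ length ys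
unique-length []       ys _           _   = z≤n
unique-length (x ∷ xs) ys (x∉ ∷ xs!) xs⊆ with ∈-∃++ (xs⊆ (here refl))
... | A , B , refl = subst (suc (length xs) ≤_) (sym (length-++-sucʳ A x B))
                       (s≤s (unique-length xs (A ++ B) xs! xs⊆A++B))
  where
  xs⊆A++B : ∀ {y} → y ∈ xs → y ∈ A ++ B
  xs⊆A++B m with ∈-++⁻ A (xs⊆ (there m))
  ... | inj₁ mA          = ∈-++⁺ˡ mA
  ... | inj₂ (here refl) = ⊥-elim (All.lookup x∉ m refl)
  ... | inj₂ (there mB)  = ∈-++⁺ʳ A mB

-- pigeonhole: a duplicate-free word of length n+1 with letters ≤ n contains n
max-∈ : ∀ n x → Unique x → All (_< suc n) x → length x ≡ suc n → n ∈ x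
max-∈ n x x! bound len with n ∈? x
... | yes n∈x = n∈x
... | no  n∉x = ⊥-elim (<-irrefl refl (begin-strict
      n            <⟨ n<1+n n ⟩
      suc n        ≡⟨ sym len ⟩
      length x     ≤⟨ unique-length x (upTo n) x! x⊆upTo ⟩
      length (upTo n) ≡⟨ length-upTo n ⟩
      n            ∎))
  where
  open ≤-Reasoning
  x⊆upTo : ∀ {y} → y ∈ x → y ∈ upTo n
  x⊆upTo m = ∈-upTo⁺ (≤∧≢⇒< (≤-pred (All.lookup bound m)) (λ { refl → n∉x m }))

allLists : ℕ → ℕ → List (List ℕ)
allLists n zero    = [] ∷ []
allLists n (suc k) = cartesianProductWith _∷_ (upTo n) (allLists n k)

allLists-unique : ∀ n k → Unique (allLists n k)
allLists-unique n zero    = [] ∷ []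
allLists-unique n (suc k) =
  Unique.cartesianProductWith⁺ _∷_ (λ { refl → refl , refl }) (Unique.upTo⁺ n) (allLists-unique n k)

IsWord : ℕ → ℕ → List ℕ → Set
IsWord n k x = length x ≡ k × All (_< n) x

allLists⁺ : ∀ n k x → IsWord n k x → x ∈ allLists n k
allLists⁺ n zero    []      (refl , [])        = here refl
allLists⁺ n (suc k) (a ∷ x) (refl , a<n ∷ all) =
  ∈-cartesianProductWith⁺ _∷_ (∈-upTo⁺ a<n) (allLists⁺ n k x (refl , all))

allLists⁻ : ∀ n k {x} → x ∈ allLists n k → IsWord n k x
allLists⁻ n zero    (here refl) = refl , []
allLists⁻ n (suc k) m with ∈-cartesianProductWith⁻ _∷_ (upTo n) (allLists n k) m
... | a , x , a∈ , x∈ , refl =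
  let (len , all) = allLists⁻ n k x∈ in cong suc len , ∈-upTo⁻ a∈ ∷ all

unique? : (x : List ℕ) → Dec (Unique x)
unique? = UniqueDec.unique? _≟_

permCount : {P : List ℕ → Set} → Decidable P → ℕ → ℕ
permCount P? N = count (λ x → unique? x ×-dec P? x) (allLists N N)

permCount-cong : ∀ {P Q : List ℕ → Set} (P? : Decidable P) (Q? : Decidable Q) N →
  (∀ z → IsWord N N z → P z ⇔ Q z) → permCount P? N ≡ permCount Q? N
permCount-cong P? Q? N P⇔Q = count-cong _ _ (allLists N N) λ m →
  let e = P⇔Q _ (allLists⁻ N N m) in mk⇔ (λ (u , p) → u , ⇔.to e p) (λ (u , q) → u , ⇔.from e q)

permCount-none : ∀ {P : List ℕ → Set} (P? : Decidable P) N → (∀ z → IsWord N N z → ¬ P z) → permCount P? N ≡ 0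
permCount-none P? N ¬P = count-none _ (allLists N N) (λ m (_ , p) → ¬P _ (allLists⁻ N N m) p)

maxAt? : ∀ p M x → Dec (at x p ≡ just M)
maxAt? p M x = Maybe.≡-dec _≟_ (at x p) (just M)

permCount-maxAt : ∀ {P : List ℕ → Set} (P? : Decidable P) n p → p ≤ n →
  count (λ x → (unique? x ×-dec P? x) ×-dec maxAt? p n x) (allLists (suc n) (suc n))
  ≡ permCount (λ z → P? (ins p n z)) n
permCount-maxAt {P} P? n p p≤n = count-bijection _ _ (allLists (suc n) (suc n)) (allLists n n)
  (allLists-unique (suc n) (suc n)) (allLists-unique n n) (del p) (ins p n) remove insert
  where
  remove : ∀ {x} → x ∈ allLists (suc n) (suc n) → (Unique x × P x) × at x p ≡ just n →
    del p x ∈ allLists n n × (Unique (del p x) × P (ins p n (del p x))) × ins p n (del p x) ≡ x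
  remove {x} x∈ ((x! , px) , atp) with allLists⁻ (suc n) (suc n) x∈
  ... | lenx , boundx = allLists⁺ n n z (lenz , boundz) , (z! , subst P (sym x≡) px) , x≡
    where
    z = del p x
    x≡ = ins-del x p atp
    n∉z×z! = ⇔.to (unique-ins p n z) (subst Unique (sym x≡) x!)
    z! = proj₂ n∉z×z!
    lenz : length z ≡ n
    lenz = suc-injective (trans (sym (length-ins p n z)) (trans (cong length x≡) lenx))
    -- the letters of z are those of x other than n
    boundz : All (_< n) z
    boundz = All.tabulate λ {y} y∈z →
      ≤∧≢⇒< (≤-pred (All.lookup (all-ins⁻ p n z (subst (All (_< suc n)) (sym x≡) boundx)) y∈z))
            (λ { refl → proj₁ n∉z×z! y∈z })
  insert : ∀ {z} → z ∈ allLists n n → Unique z × P (ins p n z) →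
    ins p n z ∈ allLists (suc n) (suc n) × ((Unique (ins p n z) × P (ins p n z)) × at (ins p n z) p ≡ just n)
    × del p (ins p n z) ≡ z
  insert {z} z∈ (z! , pz) =
    allLists⁺ _ _ _ (trans (length-ins p n z) (cong suc len) , all-ins p n z ≤-refl (All.map m<n⇒m<1+n bound)) ,
    ((⇔.from (unique-ins p n z) (n∉z , z!) , pz) , at-ins z p p≤len) , del-ins z p p≤len
    where
    len = proj₁ (allLists⁻ n n z∈)
    bound = proj₂ (allLists⁻ n n z∈)
    p≤len = subst (p ≤_) (sym len) p≤n
    n∉z : n ∉ z
    n∉z n∈z = <-irrefl refl (All.lookup bound n∈z)

permCount-suc : ∀ {P : List ℕ → Set} (P? : Decidable P) n →
  permCount P? (suc n) ≡ sumTo (suc n) (λ p → permCount (λ z → P? (ins p n z)) n)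
permCount-suc {P} P? n =
  trans (count-classes (λ p → maxAt? p n) _ (suc n) _ maxPosition)
        (sumTo-cong (suc n) λ p p<1+n → permCount-maxAt P? n p (≤-pred p<1+n))
  where
  maxPosition : ∀ {x} → x ∈ allLists (suc n) (suc n) → Unique x × P x →
    InUniqueClass (λ p → maxAt? p n) (suc n) x
  maxPosition {x} x∈ (x! , _) with allLists⁻ _ _ x∈
  ... | len , bound with ∈-at x (max-∈ n x x! bound len)
  ... | p , p< , atp = p , subst (p <_) len p< , atp , λ j atj → at-unique x j p x! atj atp

peakIn : ℕ → ℕ → ℕ → List ℕ
peakIn a b c with a <? b | c <? b
... | yes _ | yes _ = [ 1 ]
... | _     | _     = []

peaks : List ℕ → List ℕ
peaks (a ∷ b ∷ c ∷ w) = peakIn a b c ++ map suc (peaks (b ∷ c ∷ w))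
peaks _               = []

peakIn-yes : ∀ {a b c} → a < b → c < b → peakIn a b c ≡ [ 1 ]
peakIn-yes {a} {b} {c} a<b c<b with a <? b | c <? b
... | yes _   | yes _   = refl
... | no a≮b  | _       = ⊥-elim (a≮b a<b)
... | yes _   | no c≮b  = ⊥-elim (c≮b c<b)

peakIn-noˡ : ∀ {a b c} → b < a → peakIn a b c ≡ []
peakIn-noˡ {a} {b} {c} b<a with a <? b | c <? b
... | yes a<b | yes _ = ⊥-elim (<-asym a<b b<a)
... | no _    | _     = refl
... | yes _   | no _  = refl

peakIn-noʳ : ∀ {a b c} → b < c → peakIn a b c ≡ []
peakIn-noʳ {a} {b} {c} b<c with a <? b | c <? b
... | yes _ | yes c<b = ⊥-elim (<-asym c<b b<c)
... | no _  | _       = refl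
... | yes _ | no _    = refl

peaks-bound : ∀ w {i} → i ∈ peaks w → suc i < length w
peaks-bound (a ∷ b ∷ c ∷ w) {i} i∈ with ∈-++⁻ (peakIn a b c) i∈
... | inj₂ i∈rest with ∈-map⁻ suc i∈rest
...   | j , j∈ , refl = s≤s (peaks-bound (b ∷ c ∷ w) j∈)
peaks-bound (a ∷ b ∷ c ∷ w) {i} i∈ | inj₁ i∈peak with a <? b | c <? b
... | yes _ | yes _ with i∈peak
...   | here refl = s≤s (s≤s (s≤s z≤n))
peaks-bound (a ∷ b ∷ c ∷ w) {i} i∈ | inj₁ () | no _  | _
peaks-bound (a ∷ b ∷ c ∷ w) {i} i∈ | inj₁ () | yes _ | no _

peaks-max-front : ∀ M L → All (_< M) L → peaks (M ∷ L) ≡ map suc (peaks L)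
peaks-max-front M []              _         = refl
peaks-max-front M (b ∷ [])        _         = refl
peaks-max-front M (b ∷ c ∷ L) (b<M ∷ _) = cong (_++ map suc (peaks (b ∷ c ∷ L))) (peakIn-noˡ b<M)

peaks-max-end : ∀ M L → All (_< M) L → peaks (ins (length L) M L) ≡ peaks L
peaks-max-end M []              _              = refl
peaks-max-end M (a ∷ [])        _              = refl
peaks-max-end M (a ∷ b ∷ [])    (_ ∷ b<M ∷ []) = cong (_++ []) (peakIn-noʳ b<M)
peaks-max-end M (a ∷ b ∷ c ∷ L) (_ ∷ all)      =
  cong (λ t → peakIn a b c ++ map suc t) (peaks-max-end M (b ∷ c ∷ L) all)

peaks-max-inside : ∀ M q L → All (_< M) L → 1 ≤ q → q < length L →
  peaks (ins q M L) ≡ peaks (take q L) ++ q ∷ map (suc q +_) (peaks (drop q L))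
peaks-max-inside M 1 (a ∷ b ∷ L) (a<M ∷ b<M ∷ all) _ _ = begin
    peakIn a M b ++ map suc (peaks (M ∷ b ∷ L))
  ≡⟨ cong₂ _++_ (peakIn-yes a<M b<M) (cong (map suc) (peaks-max-front M (b ∷ L) (b<M ∷ all))) ⟩
    1 ∷ map suc (map suc (peaks (b ∷ L)))
  ≡⟨ cong (1 ∷_) (sym (map-∘ (peaks (b ∷ L)))) ⟩
    1 ∷ map (2 +_) (peaks (b ∷ L))
  ∎ where open ≡-Reasoning
peaks-max-inside M 2 (a ∷ b ∷ c ∷ L) (a<M ∷ b<M ∷ all) _ _ = begin
    peakIn a b M ++ map suc (peaks (b ∷ M ∷ c ∷ L))
  ≡⟨ cong₂ _++_ (peakIn-noʳ b<M) (cong (map suc) (peaks-max-inside M 1 (b ∷ c ∷ L) (b<M ∷ all) ≤-refl (s≤s (s≤s z≤n)))) ⟩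
    map suc (1 ∷ map (2 +_) (peaks (c ∷ L)))
  ≡⟨ cong (2 ∷_) (sym (map-∘ (peaks (c ∷ L)))) ⟩
    2 ∷ map (3 +_) (peaks (c ∷ L))
  ∎ where open ≡-Reasoning
peaks-max-inside M (suc (suc (suc q))) (a ∷ b ∷ c ∷ L) (_ ∷ all) _ (s≤s (s≤s q<)) = begin
    peakIn a b c ++ map suc (peaks (ins (2 + q) M (b ∷ c ∷ L)))
  ≡⟨ cong (λ t → peakIn a b c ++ map suc t) (peaks-max-inside M (2 + q) (b ∷ c ∷ L) all (s≤s z≤n) (s≤s q<)) ⟩
    peakIn a b c ++ map suc (peaks T ++ (2 + q) ∷ map (3 + q +_) D)
  ≡⟨ cong (peakIn a b c ++_) (map-++ suc (peaks T) ((2 + q) ∷ map (3 + q +_) D)) ⟩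
    peakIn a b c ++ (map suc (peaks T) ++ (3 + q) ∷ map suc (map (3 + q +_) D))
  ≡⟨ cong (λ t → peakIn a b c ++ (map suc (peaks T) ++ (3 + q) ∷ t)) (sym (map-∘ D)) ⟩
    peakIn a b c ++ (map suc (peaks T) ++ (3 + q) ∷ map (4 + q +_) D)
  ≡⟨ sym (++-assoc (peakIn a b c) (map suc (peaks T)) _) ⟩
    (peakIn a b c ++ map suc (peaks T)) ++ (3 + q) ∷ map (4 + q +_) D
  ∎
  where
  open ≡-Reasoning
  T = b ∷ c ∷ take q L
  D = peaks (drop q L)
peaks-max-inside M 1 (a ∷ [])         _ _ (s≤s ())
peaks-max-inside M 2 (a ∷ [])         _ _ (s≤s ())
peaks-max-inside M 2 (a ∷ b ∷ [])     _ _ (s≤s (s≤s ()))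

-- the word 0 π₁ … π_N of the permutation π encoded by x (letters shifted to 1…N, π₀ = 0)
word : List ℕ → List ℕ
word x = 0 ∷ map suc x

Peakless : List ℕ → Set
Peakless w = peaks w ≡ []

SinglePeak : ℕ → List ℕ → Set
SinglePeak m x = peaks (word x) ≡ [ m ]

-- π₀ < π₁ < … < π_k, and π_{k+1} … π_N has no interior peak
Split : ℕ → List ℕ → Set
Split k x = Peakless (take (suc k) (word x)) × Peakless (drop (suc k) (word x))

singlePeak? : ∀ m x → Dec (SinglePeak m x)
singlePeak? m x = List.≡-dec _≟_ (peaks (word x)) [ m ]

split? : ∀ k x → Dec (Split k x)
split? k x = List.≡-dec _≟_ (peaks (take (suc k) (word x))) [] ×-dec List.≡-dec _≟_ (peaks (drop (suc k) (word x))) []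

word-ins : ∀ p M z → word (ins p M z) ≡ ins (suc p) (suc M) (word z)
word-ins p M z = cong (0 ∷_) (map-suc-ins p z)
  where
  map-suc-ins : ∀ p z → map suc (ins p M z) ≡ ins p (suc M) (map suc z)
  map-suc-ins zero    z       = refl
  map-suc-ins (suc p) []      = refl
  map-suc-ins (suc p) (a ∷ z) = cong (suc a ∷_) (map-suc-ins p z)

module MaxInsertion (n : ℕ) (z : List ℕ) (len : length z ≡ n) (bound : All (_< n) z) where

  L = word z

  lenL : length L ≡ suc n
  lenL = cong suc (trans (length-map suc z) len)

  boundL : All (_< suc n) L
  boundL = s≤s z≤n ∷ All.map⁺ (All.map s≤s bound)

  length-take-L : ∀ k → k ≤ suc n → length (take k L) ≡ k
  length-take-L k k≤ = trans (length-take k L) (m≤n⇒m⊓n≡m (subst (k ≤_) (sym lenL) k≤))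

  length-drop-L : ∀ k → length (drop (suc k) L) ≡ n ∸ k
  length-drop-L k = trans (length-drop (suc k) L) (cong (_∸ suc k) lenL)

  ins≤L : ∀ {p} → p ≤ n → suc p ≤ length L
  ins≤L {p} p≤n = subst (suc p ≤_) (sym lenL) (s≤s p≤n)

  peaks-end : peaks (word (ins n n z)) ≡ peaks L
  peaks-end = trans (cong peaks (word-ins n n z))
    (subst (λ t → peaks (ins (suc t) (suc n) L) ≡ peaks L) (trans (length-map suc z) len) (peaks-max-end (suc n) L boundL))

  peaks-inside : ∀ p → p < n →
    peaks (word (ins p n z)) ≡ peaks (take (suc p) L) ++ suc p ∷ map (2 + p +_) (peaks (drop (suc p) L))
  peaks-inside p p<n = trans (cong peaks (word-ins p n z))
    (peaks-max-inside (suc n) (suc p) L boundL (s≤s z≤n) (subst (suc p <_) (sym lenL) (s≤s p<n)))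

  singlePeak-end : ∀ m → SinglePeak m (ins n n z) ⇔ SinglePeak m z
  singlePeak-end m = mk⇔ (trans (sym peaks-end)) (trans peaks-end)

  singlePeak-inside : ∀ m p → p < n → SinglePeak m (ins p n z) ⇔ (suc p ≡ m × Split p z)
  singlePeak-inside m p p<n = mk⇔ to from
    where
    to : SinglePeak m (ins p n z) → suc p ≡ m × Split p z
    to single with ++-∷-singleton (peaks (take (suc p) L)) (trans (sym (peaks-inside p p<n)) single)
    ... | left , p+1≡m , right = p+1≡m , left , map-≡-[] _ right
    from : suc p ≡ m × Split p z → SinglePeak m (ins p n z)
    from (refl , left , right) = trans (peaks-inside p p<n)
      (cong₂ (λ A B → A ++ suc p ∷ map (2 + p +_) B) left right)

  take-before : ∀ k p → p < k → take (suc k) (word (ins p n z)) ≡ ins (suc p) (suc n) (take k L)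
  take-before k p p<k = trans (cong (take (suc k)) (word-ins p n z)) (take-ins-before (suc p) k L (suc n) p<k)

  drop-before : ∀ k p → p < k → drop (suc k) (word (ins p n z)) ≡ drop k L
  drop-before k p p<k = trans (cong (drop (suc k)) (word-ins p n z)) (drop-ins-before (suc p) k L (suc n) p<k)

  take-after : ∀ k p → k ≤ p → p ≤ n → take (suc k) (word (ins p n z)) ≡ take (suc k) L
  take-after k p k≤p p≤n = trans (cong (take (suc k)) (word-ins p n z))
    (take-ins-after (suc k) (suc p) L (suc n) (s≤s k≤p) (ins≤L p≤n))

  drop-after : ∀ k p → k ≤ p → p ≤ n → drop (suc k) (word (ins p n z)) ≡ ins (p ∸ k) (suc n) (drop (suc k) L)
  drop-after k p k≤p p≤n = trans (cong (drop (suc k)) (word-ins p n z))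
    (drop-ins-after (suc k) (suc p) L (suc n) (s≤s k≤p) (ins≤L p≤n))

  split-prefix-end : ∀ p → p ≤ n → Split (suc p) (ins p n z) ⇔ Split p z
  split-prefix-end p p≤n = mk⇔
    (λ (left , right) → trans (sym prefix) (trans (cong peaks (sym (take-before (suc p) p ≤-refl))) left) ,
                        trans (cong peaks (sym (drop-before (suc p) p ≤-refl))) right)
    (λ (left , right) → trans (cong peaks (take-before (suc p) p ≤-refl)) (trans prefix left) ,
                        trans (cong peaks (drop-before (suc p) p ≤-refl)) right)
    where
    prefix : peaks (ins (suc p) (suc n) (take (suc p) L)) ≡ peaks (take (suc p) L)
    prefix = subst (λ t → peaks (ins t (suc n) (take (suc p) L)) ≡ peaks (take (suc p) L))
      (length-take-L (suc p) (s≤s p≤n)) (peaks-max-end (suc n) (take (suc p) L) (All.take⁺ (suc p) boundL))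

  split-prefix-inside : ∀ k p → suc p < k → k ≤ suc n → ¬ Split k (ins p n z)
  split-prefix-inside k p p+1<k k≤ (left , _) = ++-∷-≢-[] (peaks (take (suc p) (take k L))) (begin
      peaks (take (suc p) (take k L)) ++ suc p ∷ map (2 + p +_) (peaks (drop (suc p) (take k L)))
    ≡⟨ sym (peaks-max-inside (suc n) (suc p) (take k L) (All.take⁺ k boundL) (s≤s z≤n)
           (subst (suc p <_) (sym (length-take-L k k≤)) p+1<k)) ⟩
      peaks (ins (suc p) (suc n) (take k L))
    ≡⟨ cong peaks (sym (take-before k p (<-trans (n<1+n p) p+1<k))) ⟩
      peaks (take (suc k) (word (ins p n z)))
    ≡⟨ left ⟩
      []
    ∎)
    where open ≡-Reasoning

  split-suffix-front : ∀ k → k ≤ n → Split k (ins k n z) ⇔ Split k z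
  split-suffix-front k k≤n = mk⇔
    (λ (left , right) → trans (cong peaks (sym (take-after k k ≤-refl k≤n))) left ,
                        map-≡-[] _ (trans (sym front) (trans (cong peaks (sym (drop-after k k ≤-refl k≤n))) right)))
    (λ (left , right) → trans (cong peaks (take-after k k ≤-refl k≤n)) left ,
                        trans (cong peaks (drop-after k k ≤-refl k≤n)) (trans front (cong (map suc) right)))
    where
    D = drop (suc k) L
    front : peaks (ins (k ∸ k) (suc n) D) ≡ map suc (peaks D)
    front = subst (λ t → peaks (ins t (suc n) D) ≡ map suc (peaks D)) (sym (n∸n≡0 k))
      (peaks-max-front (suc n) D (All.drop⁺ (suc k) boundL))

  split-suffix-end : ∀ k → k ≤ n → Split k (ins n n z) ⇔ Split k z
  split-suffix-end k k≤n = mk⇔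
    (λ (left , right) → trans (cong peaks (sym (take-after k n k≤n ≤-refl))) left ,
                        trans (sym end) (trans (cong peaks (sym (drop-after k n k≤n ≤-refl))) right))
    (λ (left , right) → trans (cong peaks (take-after k n k≤n ≤-refl)) left ,
                        trans (cong peaks (drop-after k n k≤n ≤-refl)) (trans end right))
    where
    D = drop (suc k) L
    end : peaks (ins (n ∸ k) (suc n) D) ≡ peaks D
    end = subst (λ t → peaks (ins t (suc n) D) ≡ peaks D) (length-drop-L k)
      (peaks-max-end (suc n) D (All.drop⁺ (suc k) boundL))

  split-suffix-inside : ∀ k p → k < p → p < n → ¬ Split k (ins p n z)
  split-suffix-inside k p k<p p<n (_ , right) = ++-∷-≢-[] (peaks (take (p ∸ k) D)) (begin
      peaks (take (p ∸ k) D) ++ (p ∸ k) ∷ map (suc (p ∸ k) +_) (peaks (drop (p ∸ k) D))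
    ≡⟨ sym (peaks-max-inside (suc n) (p ∸ k) D (All.drop⁺ (suc k) boundL) (m<n⇒0<n∸m k<p)
           (subst (p ∸ k <_) (sym (length-drop-L k)) (∸-monoˡ-< p<n (<⇒≤ k<p)))) ⟩
      peaks (ins (p ∸ k) (suc n) D)
    ≡⟨ cong peaks (sym (drop-after k p (<⇒≤ k<p) (<⇒≤ p<n))) ⟩
      peaks (drop (suc k) (word (ins p n z)))
    ≡⟨ right ⟩
      []
    ∎)
    where
    open ≡-Reasoning
    D = drop (suc k) L

peakCount : ℕ → ℕ → ℕ
peakCount m N = permCount (singlePeak? m) N

splitCount : ℕ → ℕ → ℕ
splitCount k N = permCount (split? k) N

-- a permutation of length m has no peak at m (it would need a letter after position m)
peakCount-diag : ∀ m → peakCount m m ≡ 0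
peakCount-diag m = permCount-none _ m λ z (len , _) single → <-irrefl refl
  (subst (suc m <_) (cong suc (trans (length-map suc z) len))
    (peaks-bound (word z) (subst (m ∈_) (sym single) (here refl))))

-- the maximum n of a permutation with peak set {m+1} either sits at position m of a permutation
-- split at m (where it is the peak m+1), or at the end of a permutation with peak set {m+1}
peakCount-suc : ∀ m n → suc m ≤ n → peakCount (suc m) (suc n) ≡ splitCount m n + peakCount (suc m) n
peakCount-suc m n m<n = begin
    peakCount (suc m) (suc n)
  ≡⟨ permCount-suc (singlePeak? (suc m)) n ⟩
    sumTo n f + f n
  ≡⟨ cong (_+ f n) (sumTo-upto n m<n (λ p m<p p<n → f-inside p p<n λ { refl → <-irrefl refl m<p })) ⟩
    sumTo m f + f m + f n
  ≡⟨ cong (λ s → s + f m + f n) (sumTo-zero m λ p p<m → f-inside p (<-trans p<m m<n) λ { refl → <-irrefl refl p<m }) ⟩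
    f m + f n
  ≡⟨ cong₂ _+_ f-peak f-end ⟩
    splitCount m n + peakCount (suc m) n
  ∎
  where
  open ≡-Reasoning
  f : ℕ → ℕ
  f p = permCount (λ z → singlePeak? (suc m) (ins p n z)) n
  f-inside : ∀ p → p < n → p ≢ m → f p ≡ 0
  f-inside p p<n p≢m = permCount-none _ n λ z (len , bound) single →
    p≢m (suc-injective (proj₁ (⇔.to (MaxInsertion.singlePeak-inside n z len bound (suc m) p p<n) single)))
  f-peak : f m ≡ splitCount m n
  f-peak = permCount-cong _ _ n λ z (len , bound) →
    let e = MaxInsertion.singlePeak-inside n z len bound (suc m) m m<n in
    mk⇔ (λ single → proj₂ (⇔.to e single)) (λ split → ⇔.from e (refl , split))
  f-end : f n ≡ peakCount (suc m) n
  f-end = permCount-cong _ _ n λ z (len , bound) → MaxInsertion.singlePeak-end n z len bound (suc m)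

splitAt : ℕ → ℕ → ℕ → ℕ
splitAt k n p = permCount (λ z → split? k (ins p n z)) n

-- the contribution of the maximum placed in the increasing prefix (possible only at its end)
prefixEnd : ℕ → ℕ → ℕ
prefixEnd zero    n = 0
prefixEnd (suc j) n = splitCount j n

splitAt-prefix : ∀ k n → k ≤ suc n → sumTo k (splitAt k n) ≡ prefixEnd k n
splitAt-prefix zero    n _   = refl
splitAt-prefix (suc j) n k≤ = begin
    sumTo j (splitAt (suc j) n) + splitAt (suc j) n j
  ≡⟨ cong (_+ splitAt (suc j) n j) (sumTo-zero j λ p p<j → permCount-none _ n λ z (len , bound) →
       MaxInsertion.split-prefix-inside n z len bound (suc j) p (s≤s p<j) k≤) ⟩
    splitAt (suc j) n j
  ≡⟨ permCount-cong _ _ n (λ z (len , bound) → MaxInsertion.split-prefix-end n z len bound j (≤-pred k≤)) ⟩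
    splitCount j n
  ∎
  where open ≡-Reasoning

splitAt-suffix-front : ∀ k n → k ≤ n → splitAt k n k ≡ splitCount k n
splitAt-suffix-front k n k≤n = permCount-cong _ _ n λ z (len , bound) →
  MaxInsertion.split-suffix-front n z len bound k k≤n

splitAt-suffix-end : ∀ k n → k ≤ n → splitAt k n n ≡ splitCount k n
splitAt-suffix-end k n k≤n = permCount-cong _ _ n λ z (len , bound) →
  MaxInsertion.split-suffix-end n z len bound k k≤n

splitAt-suffix-inside : ∀ k n p → k < p → p < n → splitAt k n p ≡ 0
splitAt-suffix-inside k n p k<p p<n = permCount-none _ n λ z (len , bound) →
  MaxInsertion.split-suffix-inside n z len bound k p k<p p<n

-- a permutation split at its length is the identity
splitCount-diag : ∀ n → splitCount n n ≡ 1
splitCount-diag zero    = refl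
splitCount-diag (suc n) =
  trans (trans (permCount-suc (split? (suc n)) n) (splitAt-prefix (suc n) n ≤-refl)) (splitCount-diag n)

-- suffix of length one: the maximum is either at the end of the prefix or is the last letter
splitCount-last : ∀ k → splitCount k (suc k) ≡ prefixEnd k k + splitCount k k
splitCount-last k = trans (permCount-suc (split? k) k)
  (cong₂ _+_ (splitAt-prefix k k (n≤1+n k)) (splitAt-suffix-front k k ≤-refl))

-- longer suffix: the maximum is at the end of the prefix or at one of the two ends of the suffix
splitCount-inner : ∀ k n → k < n → splitCount k (suc n) ≡ prefixEnd k n + splitCount k n + splitCount k n
splitCount-inner k n k<n = begin
    splitCount k (suc n)
  ≡⟨ permCount-suc (split? k) n ⟩
    sumTo n f + f n
  ≡⟨ cong (_+ f n) (sumTo-upto n k<n λ p k<p p<n → splitAt-suffix-inside k n p k<p p<n) ⟩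
    sumTo k f + f k + f n
  ≡⟨ cong₂ (λ a b → a + b + f n) (splitAt-prefix k n (m≤n⇒m≤1+n (<⇒≤ k<n))) (splitAt-suffix-front k n (<⇒≤ k<n)) ⟩
    prefixEnd k n + splitCount k n + f n
  ≡⟨ cong (prefixEnd k n + splitCount k n +_) (splitAt-suffix-end k n (<⇒≤ k<n)) ⟩
    prefixEnd k n + splitCount k n + splitCount k n
  ∎
  where
  open ≡-Reasoning
  f = splitAt k n

∸-suc : ∀ {k n} → k < n → n ∸ k ≡ suc (n ∸ suc k)
∸-suc {zero}  {suc n} _         = refl
∸-suc {suc k} {suc n} (s≤s k<n) = ∸-suc k<n

diag-closed : ∀ n m → n ≤ m → 2 ^ (n ∸ m) * (n C n) ≡ 1
diag-closed n m n≤m = trans (cong (λ e → 2 ^ e * (n C n)) (m≤n⇒m∸n≡0 n≤m)) (cong (1 *_) (nCn≡1 n))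

-- Pascal's rule merges the placements of the maximum at the end of the prefix with those in
-- the suffix, given the closed form at length n
prefix-pascal : ∀ k n → (∀ j → j ≤ n → splitCount j n ≡ 2 ^ (n ∸ suc j) * (n C j)) → k ≤ n →
  prefixEnd k n + 2 ^ (n ∸ k) * (n C k) ≡ 2 ^ (n ∸ k) * (suc n C k)
prefix-pascal zero    n _      _   = refl
prefix-pascal (suc j) n closed k≤n = begin
    splitCount j n + 2 ^ (n ∸ suc j) * (n C suc j)
  ≡⟨ cong (_+ 2 ^ (n ∸ suc j) * (n C suc j)) (closed j (<⇒≤ k≤n)) ⟩
    2 ^ (n ∸ suc j) * (n C j) + 2 ^ (n ∸ suc j) * (n C suc j)
  ≡⟨ sym (*-distribˡ-+ (2 ^ (n ∸ suc j)) (n C j) (n C suc j)) ⟩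
    2 ^ (n ∸ suc j) * ((n C j) + (n C suc j))
  ≡⟨ cong (2 ^ (n ∸ suc j) *_) (nCk+nC[k+1]≡[n+1]C[k+1] n j) ⟩
    2 ^ (n ∸ suc j) * (suc n C suc j)
  ∎
  where open ≡-Reasoning

-- closed form: choose the k letters of the prefix; each letter of the suffix except its minimum
-- lies to the left or to the right of the minimum
splitCount-closed : ∀ n k → k ≤ n → splitCount k n ≡ 2 ^ (n ∸ suc k) * (n C k)
splitCount-closed n k k≤n with m≤n⇒m<n∨m≡n k≤n
... | inj₂ refl = trans (splitCount-diag k) (sym (diag-closed k (suc k) (n≤1+n k)))
splitCount-closed zero    k _ | inj₁ ()
splitCount-closed (suc n) k _ | inj₁ (s≤s k≤n) =
  trans suffix-ends (prefix-pascal k n (splitCount-closed n) k≤n)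
  where
  suffix-ends : splitCount k (suc n) ≡ prefixEnd k n + 2 ^ (n ∸ k) * (n C k)
  suffix-ends with m≤n⇒m<n∨m≡n k≤n
  ... | inj₂ refl = trans (splitCount-last k)
        (cong (prefixEnd k k +_) (trans (splitCount-diag k) (sym (diag-closed k k ≤-refl))))
  ... | inj₁ k<n = begin
      splitCount k (suc n)
    ≡⟨ splitCount-inner k n k<n ⟩
      prefixEnd k n + splitCount k n + splitCount k n
    ≡⟨ +-assoc (prefixEnd k n) _ _ ⟩
      prefixEnd k n + (splitCount k n + splitCount k n)
    ≡⟨ cong (λ s → prefixEnd k n + (s + s)) (splitCount-closed n k (<⇒≤ k<n)) ⟩
      prefixEnd k n + (2 ^ (n ∸ suc k) * (n C k) + 2 ^ (n ∸ suc k) * (n C k))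
    ≡⟨ cong (prefixEnd k n +_) (double (2 ^ (n ∸ suc k)) (n C k)) ⟩
      prefixEnd k n + 2 ^ suc (n ∸ suc k) * (n C k)
    ≡⟨ cong (λ e → prefixEnd k n + 2 ^ e * (n C k)) (sym (∸-suc k<n)) ⟩
      prefixEnd k n + 2 ^ (n ∸ k) * (n C k)
    ∎
    where
    open ≡-Reasoning
    double : ∀ y c → y * c + y * c ≡ (2 * y) * c
    double = ℕ-Solver.solve-∀

-- The letter at position i, and 0 beyond the end
entry : List ℕ → ℕ → ℕ
entry []      _       = 0
entry (a ∷ w) zero    = a
entry (a ∷ w) (suc i) = entry w i

PeakAt : List ℕ → ℕ → Set
PeakAt w i = 1 ≤ i × entry w (i ∸ 1) < entry w i × entry w (suc i) < entry w i

peakAt? : ∀ w i → Dec (PeakAt w i)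
peakAt? w i = (1 ≤? i) ×-dec ((entry w (i ∸ 1) <? entry w i) ×-dec (entry w (suc i) <? entry w i))

peaks-filter : ∀ w n → length w ≡ suc n → filter (peakAt? w) (upTo n) ≡ peaks w
peaks-filter (a ∷ [])        zero          refl = refl
peaks-filter (a ∷ b ∷ [])    (suc zero)    refl = refl
peaks-filter (a ∷ b ∷ c ∷ w) (suc (suc n)) len  = begin
    filter (peakAt? W) (upTo (2 + n))
  ≡⟨ cong (λ l → filter (peakAt? W) (1 ∷ l)) (sym (map-upTo (2 +_) n)) ⟩
    filter (peakAt? W) (1 ∷ map (2 +_) (upTo n))
  ≡⟨ first-peak ⟩
    peakIn a b c ++ filter (peakAt? W) (map (2 +_) (upTo n))
  ≡⟨ cong (peakIn a b c ++_) (later-peaks (upTo n)) ⟩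
    peakIn a b c ++ map suc (filter (peakAt? W′) (map suc (upTo n)))
  ≡⟨ cong (λ l → peakIn a b c ++ map suc l)
       (trans (cong (filter (peakAt? W′)) (map-upTo suc n)) (peaks-filter W′ (suc n) (suc-injective len))) ⟩
    peakIn a b c ++ map suc (peaks W′)
  ∎
  where
  open ≡-Reasoning
  W = a ∷ b ∷ c ∷ w
  W′ = b ∷ c ∷ w
  first-peak : ∀ {xs} → filter (peakAt? W) (1 ∷ xs) ≡ peakIn a b c ++ filter (peakAt? W) xs
  first-peak {xs} with a <? b | c <? b
  ... | yes a<b | yes c<b = filter-accept (peakAt? W) {x = 1} {xs = xs} (s≤s z≤n , a<b , c<b)
  ... | no  a≮b | _       = filter-reject (peakAt? W) {x = 1} {xs = xs} (λ (_ , a<b , _) → a≮b a<b)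
  ... | yes _   | no  c≮b = filter-reject (peakAt? W) {x = 1} {xs = xs} (λ (_ , _ , c<b) → c≮b c<b)
  later-peaks : ∀ xs → filter (peakAt? W) (map (2 +_) xs) ≡ map suc (filter (peakAt? W′) (map suc xs))
  later-peaks xs = begin
      filter (peakAt? W) (map (2 +_) xs)
    ≡⟨ filter-map (peakAt? W) (2 +_) xs ⟩
      map (2 +_) (filter (λ j → peakAt? W (2 + j)) xs)
    ≡⟨ cong (map (2 +_)) (filter-cong _ _ xs λ _ → mk⇔ (λ (_ , p) → s≤s z≤n , p) (λ (_ , p) → s≤s z≤n , p)) ⟩
      map (2 +_) (filter (λ j → peakAt? W′ (suc j)) xs)
    ≡⟨ map-∘ _ ⟩
      map suc (map suc (filter (λ j → peakAt? W′ (suc j)) xs))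
    ≡⟨ cong (map suc) (sym (filter-map (peakAt? W′) suc xs)) ⟩
      map suc (filter (peakAt? W′) (map suc xs))
    ∎

toNats : ∀ {n k} → Vec (Fin n) k → List ℕ
toNats v = map toℕ (toList v)

length-toNats : ∀ {n k} (v : Vec (Fin n) k) → length (toNats v) ≡ k
length-toNats v = trans (length-map toℕ (toList v)) (length-toList v)

tabulate-toℕ : ∀ n (h : ℕ → ℕ) → tabulate {n = n} (λ i → h (toℕ i)) ≡ applyUpTo h n
tabulate-toℕ zero    h = refl
tabulate-toℕ (suc n) h = cong (h 0 ∷_) (tabulate-toℕ n (λ i → h (suc i)))

allFin-upTo : ∀ n → map toℕ (allFin n) ≡ upTo n
allFin-upTo n = trans (map-tabulate (λ i → i) toℕ) (tabulate-toℕ n (λ i → i))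

allVecs-allLists : ∀ n k → map toNats (allVecs n k) ≡ allLists n k
allVecs-allLists n zero    = refl
allVecs-allLists n (suc k) =
  trans (prepend (allFin n) (allVecs n k)) (cong₂ (cartesianProductWith _∷_) (allFin-upTo n) (allVecs-allLists n k))
  where
  prepend : ∀ (fs : List (Fin n)) (V : List (Vec (Fin n) k)) →
    map toNats (concatMap (λ x → map (x ∷_) V) fs) ≡ cartesianProductWith _∷_ (map toℕ fs) (map toNats V)
  prepend []       V = refl
  prepend (f ∷ fs) V = trans (map-++ toNats (map (f ∷_) V) (concatMap (λ x → map (x ∷_) V) fs))
    (cong₂ _++_ (trans (sym (map-∘ V)) (map-∘ V)) (prepend fs V))

entry-lookup : ∀ {n k} (v : Vec (Fin n) k) j (j<k : j < k) →
  entry (map suc (toNats v)) j ≡ suc (toℕ (lookup v (fromℕ< j<k)))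
entry-lookup (x ∷ v) zero    (s≤s z≤n) = refl
entry-lookup (x ∷ v) (suc j) (s≤s j<k) = entry-lookup v j j<k

entry-beyond : ∀ w j → length w ≤ j → entry w j ≡ 0
entry-beyond []      j       _         = refl
entry-beyond (a ∷ w) (suc j) (s≤s w≤j) = entry-beyond w j w≤j

val-entry : ∀ {n} (v : Vec (Fin n) n) i → val v i ≡ entry (word (toNats v)) i
val-entry v zero = refl
val-entry {n} v (suc j) with j <? n
... | yes j<n = sym (entry-lookup v j j<n)
... | no  j≮n = sym (entry-beyond (map suc (toNats v)) j
    (subst (_≤ j) (sym (trans (length-map suc (toNats v)) (length-toNats v))) (≮⇒≥ j≮n)))

<⇒≤∸1 : ∀ {i n} → i < n → i ≤ n ∸ 1
<⇒≤∸1 {n = suc n} i<n = ≤-pred i<n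

peakSet-peaks : ∀ {n} (v : Vec (Fin n) n) → peakSet v ≡ peaks (word (toNats v))
peakSet-peaks {n} v = trans (filter-cong (isPeak? v) (peakAt? w) (upTo n) λ i∈ → mk⇔ to (from i∈))
  (peaks-filter w n (cong suc (trans (length-map suc (toNats v)) (length-toNats v))))
  where
  w = word (toNats v)
  to : ∀ {i} → IsPeak v i → PeakAt w i
  to {i} (1≤i , _ , left , right) =
    1≤i , subst₂ _<_ (val-entry v (i ∸ 1)) (val-entry v i) left , subst₂ _<_ (val-entry v (suc i)) (val-entry v i) right
  from : ∀ {i} → i ∈ upTo n → PeakAt w i → IsPeak v i
  from {i} i∈ (1≤i , left , right) = 1≤i , <⇒≤∸1 (∈-upTo⁻ i∈) ,
    subst₂ _<_ (sym (val-entry v (i ∸ 1))) (sym (val-entry v i)) left ,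
    subst₂ _<_ (sym (val-entry v (suc i))) (sym (val-entry v i)) right

countPhat1-peakCount : ∀ m n → countPhat1 m n ≡ peakCount m n
countPhat1-peakCount m n = trans
  (count-map (inPhat1? m n) (λ x → unique? x ×-dec singlePeak? m x) toNats inPhat1⇔ (allVecs n n))
  (cong (count (λ x → unique? x ×-dec singlePeak? m x)) (allVecs-allLists n n))
  where
  inPhat1⇔ : ∀ v → InPhat1 m n v ⇔ (Unique (toNats v) × SinglePeak m (toNats v))
  inPhat1⇔ v = mk⇔
    (λ (perm , peakSet≡) → Unique.map⁺ Fin.toℕ-injective perm , trans (sym (peakSet-peaks v)) peakSet≡)
    (λ (unique , single) → Unique.map⁻ unique , trans (peakSet-peaks v) single)

-- integers enter only here, so that their prefix +_ does not clash with sections of ℕ addition above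
open import Data.Integer as ℤ using (ℤ; +_; -1ℤ)
import Data.Integer.Properties as ℤ
import Data.Integer.Tactic.RingSolver as ℤ-Solver

-- the summand for i = j + 1:  2^(n-i) C(n, i-1) (-1)^(m-i)
term : ℕ → ℕ → ℕ → ℤ
term m n j = + (2 ^ (n ∸ suc j) * (n C j)) ℤ.* (-1ℤ ℤ.^ (m ∸ suc j))

-- Σ_{i=1}^{m} 2^(n-i) C(n, i-1) (-1)^(m-i), so that formula m n = altSum m n - (m mod 2)
altSum : ℕ → ℕ → ℤ
altSum m n = sumℤ (map (term m n) (upTo m))

sumℤ-++ : ∀ xs ys → sumℤ (xs ++ ys) ≡ sumℤ xs ℤ.+ sumℤ ys
sumℤ-++ []       ys = sym (ℤ.+-identityˡ (sumℤ ys))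
sumℤ-++ (x ∷ xs) ys = trans (cong (ℤ._+_ x) (sumℤ-++ xs ys)) (sym (ℤ.+-assoc x (sumℤ xs) (sumℤ ys)))

sumℤ-neg : ∀ (f g : ℕ → ℤ) xs → (∀ {j} → j ∈ xs → g j ≡ ℤ.- f j) → sumℤ (map g xs) ≡ ℤ.- sumℤ (map f xs)
sumℤ-neg f g []       _    = refl
sumℤ-neg f g (x ∷ xs) g≡-f = trans (cong₂ ℤ._+_ (g≡-f (here refl)) (sumℤ-neg f g xs (λ m → g≡-f (there m))))
  (sym (ℤ.neg-distrib-+ (f x) (sumℤ (map f xs))))

-- raising the upper limit flips every sign and adds the new last summand
altSum-suc : ∀ m n → altSum (suc m) n ≡ + (2 ^ (n ∸ suc m) * (n C m)) ℤ.- altSum m n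
altSum-suc m n = begin
    sumℤ (map (term (suc m) n) (upTo (suc m)))
  ≡⟨ cong (λ l → sumℤ (map (term (suc m) n) l)) (sym (upTo-∷ʳ m)) ⟩
    sumℤ (map (term (suc m) n) (upTo m ++ [ m ]))
  ≡⟨ cong sumℤ (map-++ (term (suc m) n) (upTo m) [ m ]) ⟩
    sumℤ (map (term (suc m) n) (upTo m) ++ [ term (suc m) n m ])
  ≡⟨ sumℤ-++ (map (term (suc m) n) (upTo m)) [ term (suc m) n m ] ⟩
    sumℤ (map (term (suc m) n) (upTo m)) ℤ.+ (term (suc m) n m ℤ.+ + 0)
  ≡⟨ cong₂ (λ a b → a ℤ.+ (b ℤ.+ + 0)) (sumℤ-neg (term m n) (term (suc m) n) (upTo m) flip) last ⟩
    ℤ.- altSum m n ℤ.+ (T ℤ.+ + 0)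
  ≡⟨ rearrange (altSum m n) T ⟩
    T ℤ.- altSum m n
  ∎
  where
  open ≡-Reasoning
  open ℤ-Solver using (solve-∀)
  T = + (2 ^ (n ∸ suc m) * (n C m))
  flip : ∀ {j} → j ∈ upTo m → term (suc m) n j ≡ ℤ.- term m n j
  flip {j} j∈ = trans (cong (λ e → + (2 ^ (n ∸ suc j) * (n C j)) ℤ.* (-1ℤ ℤ.^ e)) (∸-suc (∈-upTo⁻ j∈)))
    (negate (+ (2 ^ (n ∸ suc j) * (n C j))) (-1ℤ ℤ.^ (m ∸ suc j)))
    where
    negate : ∀ a b → a ℤ.* (-1ℤ ℤ.* b) ≡ ℤ.- (a ℤ.* b)
    negate = solve-∀
  last : term (suc m) n m ≡ T
  last = trans (cong (λ e → T ℤ.* (-1ℤ ℤ.^ e)) (n∸n≡0 m)) (ℤ.*-identityʳ T)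
  rearrange : ∀ a t → ℤ.- a ℤ.+ (t ℤ.+ + 0) ≡ t ℤ.- a
  rearrange = solve-∀

-- raising n by one adds 2^(n-m-1) C(n, m) (for 1 ≤ m+1 ≤ n), by Pascal's rule and induction on m
altSum-step : ∀ m n → suc m ≤ n → altSum (suc m) (suc n) ≡ + (2 ^ (n ∸ suc m) * (n C m)) ℤ.+ altSum (suc m) n
altSum-step zero (suc n) _ = begin
    + (2 ^ suc n * 1) ℤ.* + 1 ℤ.+ + 0
  ≡⟨ cong (λ t → t ℤ.* + 1 ℤ.+ + 0) (trans (cong +_ (double (2 ^ n))) (ℤ.pos-+ (2 ^ n * 1) (2 ^ n * 1))) ⟩
    (+ (2 ^ n * 1) ℤ.+ + (2 ^ n * 1)) ℤ.* + 1 ℤ.+ + 0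
  ≡⟨ simplify (+ (2 ^ n * 1)) ⟩
    + (2 ^ n * 1) ℤ.+ (+ (2 ^ n * 1) ℤ.* + 1 ℤ.+ + 0)
  ∎
  where
  open ≡-Reasoning
  double : ∀ x → 2 * x * 1 ≡ x * 1 + x * 1
  double = ℕ-Solver.solve-∀
  simplify : ∀ a → (a ℤ.+ a) ℤ.* + 1 ℤ.+ + 0 ≡ a ℤ.+ (a ℤ.* + 1 ℤ.+ + 0)
  simplify = ℤ-Solver.solve-∀
altSum-step (suc m) n m+1<n = begin
    altSum (suc (suc m)) (suc n)
  ≡⟨ altSum-suc (suc m) (suc n) ⟩
    + X ℤ.- altSum (suc m) (suc n)
  ≡⟨ cong (λ s → + X ℤ.- s) (altSum-step m n (<⇒≤ m+1<n)) ⟩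
    + X ℤ.- (+ D ℤ.+ altSum (suc m) n)
  ≡⟨ cong (λ t → t ℤ.- (+ D ℤ.+ altSum (suc m) n)) split-X ⟩
    (+ D ℤ.+ + Y ℤ.+ + Y) ℤ.- (+ D ℤ.+ altSum (suc m) n)
  ≡⟨ rearrange (+ D) (+ Y) (altSum (suc m) n) ⟩
    + Y ℤ.+ (+ Y ℤ.- altSum (suc m) n)
  ≡⟨ cong (ℤ._+_ (+ Y)) (sym (altSum-suc (suc m) n)) ⟩
    + Y ℤ.+ altSum (suc (suc m)) n
  ∎
  where
  open ≡-Reasoning
  p = 2 ^ (n ∸ suc (suc m))
  X = 2 ^ (n ∸ suc m) * (suc n C suc m)
  D = 2 ^ (n ∸ suc m) * (n C m)
  Y = p * (n C suc m)
  -- X = 2p (C(n,m) + C(n,m+1)) = D + 2 Y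
  split-X : + X ≡ + D ℤ.+ + Y ℤ.+ + Y
  split-X = begin
      + X
    ≡⟨ cong (λ e → + (2 ^ e * (suc n C suc m))) (∸-suc m+1<n) ⟩
      + (2 * p * (suc n C suc m))
    ≡⟨ cong (λ c → + (2 * p * c)) (sym (nCk+nC[k+1]≡[n+1]C[k+1] n m)) ⟩
      + (2 * p * ((n C m) + (n C suc m)))
    ≡⟨ cong +_ (expand p (n C m) (n C suc m)) ⟩
      + (2 * p * (n C m) + Y + Y)
    ≡⟨ trans (ℤ.pos-+ (2 * p * (n C m) + Y) Y) (cong (ℤ._+ + Y) (ℤ.pos-+ (2 * p * (n C m)) Y)) ⟩
      + (2 * p * (n C m)) ℤ.+ + Y ℤ.+ + Y
    ≡⟨ cong (λ e → + (2 ^ e * (n C m)) ℤ.+ + Y ℤ.+ + Y) (sym (∸-suc m+1<n)) ⟩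
      + D ℤ.+ + Y ℤ.+ + Y
    ∎
    where
    expand : ∀ p a b → 2 * p * (a + b) ≡ 2 * p * a + p * b + p * b
    expand = ℕ-Solver.solve-∀
  rearrange : ∀ d y s → (d ℤ.+ y ℤ.+ y) ℤ.- (d ℤ.+ s) ≡ y ℤ.+ (y ℤ.- s)
  rearrange = ℤ-Solver.solve-∀

parity : ∀ k → k % 2 + suc k % 2 ≡ 1
parity zero    = refl
parity (suc k) = trans (+-comm (suc k % 2) (k % 2)) (parity k)

[n+1]Cn≡n+1 : ∀ n → suc n C n ≡ suc n
[n+1]Cn≡n+1 n = trans (nCk≡nC[n∸k] (n≤1+n n)) (trans (cong (suc n C_) (m+n∸n≡m 1 n)) (nC1≡n (suc n)))

altSum-diag : ∀ m → altSum (suc m) (suc m) ≡ + (suc m % 2)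
altSum-diag zero    = refl
altSum-diag (suc m) = begin
    altSum (suc (suc m)) (suc (suc m))
  ≡⟨ altSum-suc (suc m) (suc (suc m)) ⟩
    + (2 ^ (suc m ∸ suc m) * (suc (suc m) C suc m)) ℤ.- altSum (suc m) (suc (suc m))
  ≡⟨ cong₂ (λ a b → a ℤ.- b) (cong +_ (top (suc m))) (altSum-step m (suc m) ≤-refl) ⟩
    + suc (suc m) ℤ.- (+ (2 ^ (m ∸ m) * (suc m C m)) ℤ.+ altSum (suc m) (suc m))
  ≡⟨ cong₂ (λ a b → + suc (suc m) ℤ.- (+ a ℤ.+ b)) (top m) (altSum-diag m) ⟩
    + suc (suc m) ℤ.- (+ suc m ℤ.+ + (suc m % 2))
  ≡⟨ cong (λ t → t ℤ.- (+ suc m ℤ.+ + (suc m % 2))) split ⟩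
    + suc m ℤ.+ + (suc m % 2) ℤ.+ + (suc (suc m) % 2) ℤ.- (+ suc m ℤ.+ + (suc m % 2))
  ≡⟨ cancel (+ suc m ℤ.+ + (suc m % 2)) (+ (suc (suc m) % 2)) ⟩
    + (suc (suc m) % 2)
  ∎
  where
  open ≡-Reasoning
  top : ∀ n → 2 ^ (n ∸ n) * (suc n C n) ≡ suc n
  top n = trans (cong (λ e → 2 ^ e * (suc n C n)) (n∸n≡0 n)) (trans (*-identityˡ _) ([n+1]Cn≡n+1 n))
  split : + suc (suc m) ≡ + suc m ℤ.+ + (suc m % 2) ℤ.+ + (suc (suc m) % 2)
  split = begin
      + suc (suc m)
    ≡⟨ cong +_ (+-comm 1 (suc m)) ⟩
      + (suc m + 1)
    ≡⟨ cong (λ t → + (suc m + t)) (sym (parity (suc m))) ⟩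
      + (suc m + (suc m % 2 + suc (suc m) % 2))
    ≡⟨ cong +_ (sym (+-assoc (suc m) _ _)) ⟩
      + (suc m + suc m % 2 + suc (suc m) % 2)
    ≡⟨ trans (ℤ.pos-+ (suc m + suc m % 2) (suc (suc m) % 2)) (cong (ℤ._+ + (suc (suc m) % 2)) (ℤ.pos-+ (suc m) (suc m % 2))) ⟩
      + suc m ℤ.+ + (suc m % 2) ℤ.+ + (suc (suc m) % 2)
    ∎
  cancel : ∀ a b → a ℤ.+ b ℤ.- a ≡ b
  cancel = ℤ-Solver.solve-∀

formula-diag : ∀ m → formula m m ≡ + 0
formula-diag zero    = refl
formula-diag (suc m) = trans (cong (ℤ._- + (suc m % 2)) (altSum-diag m)) (ℤ.+-inverseʳ (+ (suc m % 2)))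

formula-step : ∀ m n → suc m ≤ n →
  formula (suc m) (suc n) ≡ + (2 ^ (n ∸ suc m) * (n C m)) ℤ.+ formula (suc m) n
formula-step m n m<n = trans (cong (ℤ._- + (suc m % 2)) (altSum-step m n m<n))
  (ℤ.+-assoc (+ (2 ^ (n ∸ suc m) * (n C m))) (altSum (suc m) n) (ℤ.- + (suc m % 2)))

-- by induction on n ≥ m + 1: both sides vanish at n = m + 1 and satisfy the same recursion
peakCount-formula : ∀ {m n} → suc m ≤′ n → + peakCount (suc m) n ≡ formula (suc m) n
peakCount-formula {m} ≤′-refl = trans (cong +_ (peakCount-diag (suc m))) (sym (formula-diag (suc m)))
peakCount-formula {m} (≤′-step {n} m<′n) = begin
    + peakCount (suc m) (suc n)
  ≡⟨ cong +_ (peakCount-suc m n m<n) ⟩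
    + (splitCount m n + peakCount (suc m) n)
  ≡⟨ ℤ.pos-+ (splitCount m n) (peakCount (suc m) n) ⟩
    + splitCount m n ℤ.+ + peakCount (suc m) n
  ≡⟨ cong₂ ℤ._+_ (cong +_ (splitCount-closed n m (<⇒≤ m<n))) (peakCount-formula m<′n) ⟩
    + (2 ^ (n ∸ suc m) * (n C m)) ℤ.+ formula (suc m) n
  ≡⟨ sym (formula-step m n m<n) ⟩
    formula (suc m) (suc n)
  ∎
  where
  open ≡-Reasoning
  m<n = ≤′⇒≤ m<′n

proposition4p5 : (n m : ℕ) → 1 ≤ m → m ≤ n ∸ 1 →
    + countPhat1 m n ≡ formula m n
proposition4p5 n       zero    ()  _
proposition4p5 zero    (suc m) _   ()
proposition4p5 (suc n) (suc m) _   m≤n =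
  trans (cong +_ (countPhat1-peakCount (suc m) (suc n))) (peakCount-formula (≤⇒≤′ (m≤n⇒m≤1+n m≤n)))
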